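{- Let $k\ge2$ be an integer. The polynomial $P(x)\in\mathbb{Q}[x]$ divides $x^kP(x+1)-(x-1)^kP(x-1)$ in $\mathbb{Q}[x]$ in each of the following cases: (1) $k\equiv1\pmod 2$ and $P(x)=2x-1$; (2) $k\equiv1\pmod 4$ and $P(x)=2x^2-2x+1$; (3) $k\equiv2\pmod 6$ and $P(x)=x^2-x+1$. -}

module Defs where

open import Data.Nat using (ℕ; zero; suc)
open import Data.Rational using (ℚ; 0ℚ; 1ℚ; _+_; _*_; -_)
open import Data.List using (List; []; _∷_; map)
open import Data.Product using (Σ)
open import Relation.Binary.PropositionalEquality using (_≡_)

-- Polynomials in ℚ[x] as coefficient lists, lowest degree first.
-- Two lists represent the same polynomial iff all coefficients agree
-- (trailing zeros are irrelevant).
Poly : Set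
Poly = List ℚ

coeff : Poly → ℕ → ℚ
coeff []      _       = 0ℚ
coeff (a ∷ p) zero    = a
coeff (a ∷ p) (suc n) = coeff p n

infix 4 _≈ₚ_
_≈ₚ_ : Poly → Poly → Set
p ≈ₚ q = ∀ n → coeff p n ≡ coeff q n

infixl 6 _+ₚ_ _-ₚ_
infixl 7 _*ₚ_

_+ₚ_ : Poly → Poly → Poly
[]      +ₚ q       = q
(a ∷ p) +ₚ []      = a ∷ p
(a ∷ p) +ₚ (b ∷ q) = (a + b) ∷ (p +ₚ q)

scaleₚ : ℚ → Poly → Poly
scaleₚ c p = map (c *_) p

negₚ : Poly → Poly
negₚ p = map -_ p

_-ₚ_ : Poly → Poly → Poly
p -ₚ q = p +ₚ negₚ q

_*ₚ_ : Poly → Poly → Poly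
[]      *ₚ q = []
(a ∷ p) *ₚ q = scaleₚ a q +ₚ (0ℚ ∷ (p *ₚ q))

constₚ : ℚ → Poly
constₚ c = c ∷ []

X : Poly
X = 0ℚ ∷ 1ℚ ∷ []

_^ₚ_ : Poly → ℕ → Poly
p ^ₚ zero  = constₚ 1ℚ
p ^ₚ suc n = p *ₚ (p ^ₚ n)

compose : Poly → Poly → Poly
compose []      q = []
compose (a ∷ p) q = constₚ a +ₚ (q *ₚ compose p q)

infix 4 _∣ₚ_
_∣ₚ_ : Poly → Poly → Set
p ∣ₚ q = Σ Poly (λ r → (p *ₚ r) ≈ₚ q)

two : ℚ
two = 1ℚ + 1ℚ

X+1 : Poly
X+1 = X +ₚ constₚ 1ℚ

X-1 : Poly
X-1 = X -ₚ constₚ 1ℚ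

Tₖ : ℕ → Poly → Poly
Tₖ k P = ((X ^ₚ k) *ₚ compose P X+1) -ₚ ((X-1 ^ₚ k) *ₚ compose P X-1)

P₁ : Poly
P₁ = (- 1ℚ) ∷ two ∷ []

P₂ : Poly
P₂ = 1ℚ ∷ (- two) ∷ two ∷ []

P₃ : Poly
P₃ = 1ℚ ∷ (- 1ℚ) ∷ 1ℚ ∷ []

{-# OPTIONS --safe #-}
-- With a = x and b = x - 1, Tₖ P = aᵏ P(x+1) - bᵏ P(x-1).  In any commutative ring
--   aⁿ⁺ᵏc - bⁿ⁺ᵏe = aⁿ(aᵏc - bᵏe) + (aⁿ - bⁿ)bᵏe,
-- so if d divides aⁿ - bⁿ, divisibility of aᵏc - bᵏe by d passes from k to k + n.
-- Here x² - (x-1)² = 2x - 1, x⁴ - (x-1)⁴ = (2x - 1)(2x² - 2x + 1) and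
-- x⁶ - (x-1)⁶ = (x² - x + 1)(6x³ - 9x² + 5x - 1), while the base cases
-- T₁(2x - 1) = 3(2x - 1), T₁(2x² - 2x + 1) = 5(2x² - 2x + 1) and
-- T₂(x² - x + 1) = (6x - 3)(x² - x + 1) are direct computations.
module Submission where

open import Defs
open import Data.Nat using (ℕ; _≤_; _%_)
open import Data.Product using (_×_)
open import Relation.Binary.PropositionalEquality using (_≡_)

open import Algebra.Bundles using (CommutativeSemigroup; CommutativeRing)
open import Data.Integer using (+_)
open import Data.List using ([]; _∷_; map; drop)
open import Data.Nat using (zero; suc; _/_; NonZero) renaming (_+_ to _+ℕ_; _*_ to _*ℕ_)
open import Data.Nat.DivMod using (m≡m%n+[m/n]*n)
import Data.Nat.Properties as ℕ
open import Data.Product using (_,_)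
open import Data.Rational using (ℚ; 0ℚ; 1ℚ)
open import Data.Rational.Literals using (fromℤ)
import Data.Rational.Properties as ℚ
open import Function.Bundles using (_⇔_; mk⇔)
open import Level using (0ℓ)
open import Relation.Binary.Bundles using (Setoid)
open import Relation.Binary.Definitions using (Decidable)
open import Relation.Binary.Structures using (IsEquivalence)
import Relation.Binary.PropositionalEquality as ≡
open ≡ using (refl; isEquivalence)
import Relation.Binary.Reasoning.Setoid as SetoidReasoning
open import Relation.Nullary.Decidable using (yes; _×-dec_; True; toWitness)
import Relation.Nullary.Decidable as Dec

module _ {c ℓ} (R : CommutativeRing c ℓ) where

  open CommutativeRing R
  open import Algebra.Definitions.RawMagma *-rawMagma using (_∣ˡ_; _,_)
  open import Algebra.Properties.Group +-group using (//-rightDividesˡ)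
  open import Algebra.Properties.Magma.Divisibility *-magma using (∣ˡ-respʳ-≈)
  open import Algebra.Properties.Ring ring using (x[y-z]≈xy-xz; [y-z]x≈yx-zx)
  open import Algebra.Properties.Semiring.Exp semiring using (_^_; ^-homo-*)
  open SetoidReasoning setoid

  ∣ˡ-+ : ∀ {d x y} → d ∣ˡ x → d ∣ˡ y → d ∣ˡ x + y
  ∣ˡ-+ {d} (p , dp≈x) (q , dq≈y) = p + q , trans (distribˡ d p q) (+-cong dp≈x dq≈y)

  ∣ˡ-*ʳ : ∀ {d x} y → d ∣ˡ x → d ∣ˡ x * y
  ∣ˡ-*ʳ {d} y (p , dp≈x) = p * y , trans (sym (*-assoc d p y)) (*-congʳ dp≈x)

  ∣ˡ-*ˡ : ∀ {d x} y → d ∣ˡ x → d ∣ˡ y * x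
  ∣ˡ-*ˡ {x = x} y d∣x = ∣ˡ-respʳ-≈ (*-comm x y) (∣ˡ-*ʳ y d∣x)

  [x-y]+[y-z]≈x-z : ∀ x y z → (x - y) + (y - z) ≈ x - z
  [x-y]+[y-z]≈x-z x y z = begin
    (x - y) + (y - z)  ≈⟨ +-assoc (x - y) y (- z) ⟨
    (x - y) + y - z    ≈⟨ +-congʳ (//-rightDividesˡ y x) ⟩
    x - z              ∎

  xy-uv≈x[y-v]+[x-u]v : ∀ x y u v → x * y - u * v ≈ x * (y - v) + (x - u) * v
  xy-uv≈x[y-v]+[x-u]v x y u v = begin
    x * y - u * v                      ≈⟨ [x-y]+[y-z]≈x-z (x * y) (x * v) (u * v) ⟨
    (x * y - x * v) + (x * v - u * v)  ≈⟨ +-cong (x[y-z]≈xy-xz x y v) ([y-z]x≈yx-zx v x u) ⟨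
    x * (y - v) + (x - u) * v          ∎

  ∣ˡ-*-difference : ∀ {d x y u v} → d ∣ˡ x - u → d ∣ˡ y - v → d ∣ˡ x * y - u * v
  ∣ˡ-*-difference {x = x} {y} {u} {v} d∣x-u d∣y-v =
    ∣ˡ-respʳ-≈ (sym (xy-uv≈x[y-v]+[x-u]v x y u v)) (∣ˡ-+ (∣ˡ-*ˡ x d∣y-v) (∣ˡ-*ʳ v d∣x-u))

  ∣ˡ-^-shift : ∀ {d a b c e} n k → d ∣ˡ a ^ n - b ^ n → d ∣ˡ a ^ k * c - b ^ k * e →
               d ∣ˡ a ^ (n +ℕ k) * c - b ^ (n +ℕ k) * e
  ∣ˡ-^-shift {a = a} {b} {c} {e} n k d∣aⁿ-bⁿ d∣aᵏc-bᵏe =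
    ∣ˡ-respʳ-≈ (+-cong (reassociate a c) (-‿cong (reassociate b e)))
               (∣ˡ-*-difference d∣aⁿ-bⁿ d∣aᵏc-bᵏe)
    where
    reassociate : ∀ x z → x ^ n * (x ^ k * z) ≈ x ^ (n +ℕ k) * z
    reassociate x z = trans (sym (*-assoc (x ^ n) (x ^ k) z)) (*-congʳ (sym (^-homo-* x n k)))

  ∣ˡ-^-periodic : ∀ {d a b c e} n r → d ∣ˡ a ^ n - b ^ n → d ∣ˡ a ^ r * c - b ^ r * e →
                  ∀ m → d ∣ˡ a ^ (m *ℕ n +ℕ r) * c - b ^ (m *ℕ n +ℕ r) * e
  ∣ˡ-^-periodic n r d∣aⁿ-bⁿ d∣aʳc-bʳe zero = d∣aʳc-bʳe
  ∣ˡ-^-periodic {d} {a} {b} {c} {e} n r d∣aⁿ-bⁿ d∣aʳc-bʳe (suc m) =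
    ≡.subst (λ j → d ∣ˡ a ^ j * c - b ^ j * e) (≡.sym (ℕ.+-assoc n (m *ℕ n) r))
      (∣ˡ-^-shift n (m *ℕ n +ℕ r) d∣aⁿ-bⁿ (∣ˡ-^-periodic n r d∣aⁿ-bⁿ d∣aʳc-bʳe m))

  ∣ˡ-^-mod : ∀ {d a b c e} n r .{{_ : NonZero n}} → d ∣ˡ a ^ n - b ^ n →
             d ∣ˡ a ^ r * c - b ^ r * e → ∀ k → k % n ≡ r → d ∣ˡ a ^ k * c - b ^ k * e
  ∣ˡ-^-mod {d} {a} {b} {c} {e} n r d∣aⁿ-bⁿ d∣aʳc-bʳe k k%n≡r =
    ≡.subst (λ j → d ∣ˡ a ^ j * c - b ^ j * e) [k/n]*n+r≡k
      (∣ˡ-^-periodic n r d∣aⁿ-bⁿ d∣aʳc-bʳe (k / n))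
    where
    [k/n]*n+r≡k : k / n *ℕ n +ℕ r ≡ k
    [k/n]*n+r≡k = ≡.trans (≡.cong (k / n *ℕ n +ℕ_) (≡.sym k%n≡r))
                    (≡.trans (ℕ.+-comm (k / n *ℕ n) (k % n)) (≡.sym (m≡m%n+[m/n]*n k n)))

open import Data.Rational using (_+_; _*_; -_)

-- A record rather than _≈ₚ_ itself, so that Agda can infer the polynomials from the type.
infix 4 _≋_ _≋?_
record _≋_ (p q : Poly) : Set where
  constructor coeffwise
  field coeff-≡ : p ≈ₚ q
open _≋_ public

≋-refl : ∀ {p} → p ≋ p
≋-refl = coeffwise λ _ → refl

≋-reflexive : ∀ {p q} → p ≡ q → p ≋ q
≋-reflexive refl = ≋-refl

≋-sym : ∀ {p q} → p ≋ q → q ≋ p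
≋-sym (coeffwise e) = coeffwise λ n → ≡.sym (e n)

≋-trans : ∀ {p q r} → p ≋ q → q ≋ r → p ≋ r
≋-trans (coeffwise e) (coeffwise f) = coeffwise λ n → ≡.trans (e n) (f n)

≋-isEquivalence : IsEquivalence _≋_
≋-isEquivalence = record { refl = ≋-refl ; sym = ≋-sym ; trans = ≋-trans }

≋-setoid : Setoid 0ℓ 0ℓ
≋-setoid = record { isEquivalence = ≋-isEquivalence }

∷-cong : ∀ {a b p q} → a ≡ b → p ≋ q → a ∷ p ≋ b ∷ q
∷-cong a≡b (coeffwise e) = coeffwise λ { zero → a≡b ; (suc n) → e n }

∷-zero : ∀ {a p} → a ≡ 0ℚ → p ≋ [] → a ∷ p ≋ []
∷-zero a≡0 (coeffwise e) = coeffwise λ { zero → a≡0 ; (suc n) → e n }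

coeff-+ₚ : ∀ p q n → coeff (p +ₚ q) n ≡ coeff p n + coeff q n
coeff-+ₚ []      q       n       = ≡.sym (ℚ.+-identityˡ _)
coeff-+ₚ (a ∷ p) []      n       = ≡.sym (ℚ.+-identityʳ _)
coeff-+ₚ (a ∷ p) (b ∷ q) zero    = refl
coeff-+ₚ (a ∷ p) (b ∷ q) (suc n) = coeff-+ₚ p q n

coeff-map : ∀ (f : ℚ → ℚ) → f 0ℚ ≡ 0ℚ → ∀ p n → coeff (map f p) n ≡ f (coeff p n)
coeff-map f f0≡0 []      n       = ≡.sym f0≡0
coeff-map f f0≡0 (a ∷ p) zero    = refl
coeff-map f f0≡0 (a ∷ p) (suc n) = coeff-map f f0≡0 p n

+ₚ-cong : ∀ {p p′ q q′} → p ≋ p′ → q ≋ q′ → p +ₚ q ≋ p′ +ₚ q′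
+ₚ-cong {p} {p′} {q} {q′} (coeffwise e) (coeffwise f) = coeffwise λ n →
  ≡.trans (coeff-+ₚ p q n) (≡.trans (≡.cong₂ _+_ (e n) (f n)) (≡.sym (coeff-+ₚ p′ q′ n)))

map-cong-≋ : ∀ (f : ℚ → ℚ) → f 0ℚ ≡ 0ℚ → ∀ {p q} → p ≋ q → map f p ≋ map f q
map-cong-≋ f f0≡0 {p} {q} (coeffwise e) = coeffwise λ n →
  ≡.trans (coeff-map f f0≡0 p n) (≡.trans (≡.cong f (e n)) (≡.sym (coeff-map f f0≡0 q n)))

scaleₚ-cong : ∀ a {p q} → p ≋ q → scaleₚ a p ≋ scaleₚ a q
scaleₚ-cong a = map-cong-≋ (a *_) (ℚ.*-zeroʳ a)

negₚ-cong : ∀ {p q} → p ≋ q → negₚ p ≋ negₚ q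
negₚ-cong = map-cong-≋ -_ refl

+ₚ-assoc : ∀ p q r → (p +ₚ q) +ₚ r ≡ p +ₚ (q +ₚ r)
+ₚ-assoc []      q       r       = refl
+ₚ-assoc (a ∷ p) []      r       = refl
+ₚ-assoc (a ∷ p) (b ∷ q) []      = refl
+ₚ-assoc (a ∷ p) (b ∷ q) (c ∷ r) = ≡.cong₂ _∷_ (ℚ.+-assoc a b c) (+ₚ-assoc p q r)

+ₚ-comm : ∀ p q → p +ₚ q ≡ q +ₚ p
+ₚ-comm []      []      = refl
+ₚ-comm []      (b ∷ q) = refl
+ₚ-comm (a ∷ p) []      = refl
+ₚ-comm (a ∷ p) (b ∷ q) = ≡.cong₂ _∷_ (ℚ.+-comm a b) (+ₚ-comm p q)

+ₚ-identityʳ : ∀ p → p +ₚ [] ≡ p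
+ₚ-identityʳ []      = refl
+ₚ-identityʳ (a ∷ p) = refl

+ₚ-commutativeSemigroup : CommutativeSemigroup 0ℓ 0ℓ
+ₚ-commutativeSemigroup = record
  { Carrier = Poly
  ; _≈_ = _≡_
  ; _∙_ = _+ₚ_
  ; isCommutativeSemigroup = record
    { isSemigroup = record
      { isMagma = record { isEquivalence = isEquivalence ; ∙-cong = ≡.cong₂ _+ₚ_ }
      ; assoc = +ₚ-assoc
      }
    ; comm = +ₚ-comm
    }
  }

open import Algebra.Properties.CommutativeSemigroup +ₚ-commutativeSemigroup
  using (interchange; x∙yz≈y∙xz)

negₚ-inverseʳ : ∀ p → p +ₚ negₚ p ≋ []
negₚ-inverseʳ []      = ≋-refl
negₚ-inverseʳ (a ∷ p) = ∷-zero (ℚ.+-inverseʳ a) (negₚ-inverseʳ p)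

negₚ-inverseˡ : ∀ p → negₚ p +ₚ p ≋ []
negₚ-inverseˡ p = ≋-trans (≋-reflexive (+ₚ-comm (negₚ p) p)) (negₚ-inverseʳ p)

scaleₚ-distribˡ : ∀ a p q → scaleₚ a (p +ₚ q) ≡ scaleₚ a p +ₚ scaleₚ a q
scaleₚ-distribˡ a []      q       = refl
scaleₚ-distribˡ a (b ∷ p) []      = refl
scaleₚ-distribˡ a (b ∷ p) (c ∷ q) = ≡.cong₂ _∷_ (ℚ.*-distribˡ-+ a b c) (scaleₚ-distribˡ a p q)

scaleₚ-distribʳ : ∀ a b p → scaleₚ (a + b) p ≡ scaleₚ a p +ₚ scaleₚ b p
scaleₚ-distribʳ a b []      = refl
scaleₚ-distribʳ a b (c ∷ p) = ≡.cong₂ _∷_ (ℚ.*-distribʳ-+ c a b) (scaleₚ-distribʳ a b p)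

scaleₚ-assoc : ∀ a b p → scaleₚ (a * b) p ≡ scaleₚ a (scaleₚ b p)
scaleₚ-assoc a b []      = refl
scaleₚ-assoc a b (c ∷ p) = ≡.cong₂ _∷_ (ℚ.*-assoc a b c) (scaleₚ-assoc a b p)

scaleₚ-identity : ∀ p → scaleₚ 1ℚ p ≡ p
scaleₚ-identity []      = refl
scaleₚ-identity (a ∷ p) = ≡.cong₂ _∷_ (ℚ.*-identityˡ a) (scaleₚ-identity p)

scaleₚ-zero : ∀ p → scaleₚ 0ℚ p ≋ []
scaleₚ-zero []      = ≋-refl
scaleₚ-zero (a ∷ p) = ∷-zero (ℚ.*-zeroˡ a) (scaleₚ-zero p)

open SetoidReasoning ≋-setoid

*ₚ-congˡ : ∀ {p q q′} → q ≋ q′ → p *ₚ q ≋ p *ₚ q′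
*ₚ-congˡ {[]}    q≋q′ = ≋-refl
*ₚ-congˡ {a ∷ p} q≋q′ = +ₚ-cong (scaleₚ-cong a q≋q′) (∷-cong refl (*ₚ-congˡ {p} q≋q′))

*ₚ-zeroʳ : ∀ p → p *ₚ [] ≋ []
*ₚ-zeroʳ []      = ≋-refl
*ₚ-zeroʳ (a ∷ p) = ∷-zero refl (*ₚ-zeroʳ p)

*ₚ-∷ʳ : ∀ p b q → p *ₚ (b ∷ q) ≋ scaleₚ b p +ₚ (0ℚ ∷ p *ₚ q)
*ₚ-∷ʳ []      b q = ≋-sym (∷-zero refl ≋-refl)
*ₚ-∷ʳ (a ∷ p) b q = ∷-cong (≡.cong (_+ 0ℚ) (ℚ.*-comm a b)) (begin
  scaleₚ a q +ₚ p *ₚ (b ∷ q)                    ≈⟨ +ₚ-cong ≋-refl (*ₚ-∷ʳ p b q) ⟩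
  scaleₚ a q +ₚ (scaleₚ b p +ₚ (0ℚ ∷ p *ₚ q))  ≡⟨ x∙yz≈y∙xz (scaleₚ a q) (scaleₚ b p) _ ⟩
  scaleₚ b p +ₚ (scaleₚ a q +ₚ (0ℚ ∷ p *ₚ q))  ∎)

*ₚ-comm : ∀ p q → p *ₚ q ≋ q *ₚ p
*ₚ-comm []      q = ≋-sym (*ₚ-zeroʳ q)
*ₚ-comm (a ∷ p) q = begin
  scaleₚ a q +ₚ (0ℚ ∷ p *ₚ q)  ≈⟨ +ₚ-cong ≋-refl (∷-cong refl (*ₚ-comm p q)) ⟩
  scaleₚ a q +ₚ (0ℚ ∷ q *ₚ p)  ≈⟨ *ₚ-∷ʳ q a p ⟨
  q *ₚ (a ∷ p)                 ∎

*ₚ-congʳ : ∀ {p p′ q} → p ≋ p′ → p *ₚ q ≋ p′ *ₚ q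
*ₚ-congʳ {p} {p′} {q} p≋p′ = begin
  p *ₚ q   ≈⟨ *ₚ-comm p q ⟩
  q *ₚ p   ≈⟨ *ₚ-congˡ {q} p≋p′ ⟩
  q *ₚ p′  ≈⟨ *ₚ-comm q p′ ⟩
  p′ *ₚ q  ∎

*ₚ-distribʳ : ∀ q p p′ → (p +ₚ p′) *ₚ q ≋ p *ₚ q +ₚ p′ *ₚ q
*ₚ-distribʳ q []      p′       = ≋-refl
*ₚ-distribʳ q (a ∷ p) []       = ≋-reflexive (≡.sym (+ₚ-identityʳ _))
*ₚ-distribʳ q (a ∷ p) (b ∷ p′) = begin
  scaleₚ (a + b) q +ₚ (0ℚ ∷ (p +ₚ p′) *ₚ q)
    ≈⟨ +ₚ-cong (≋-reflexive (scaleₚ-distribʳ a b q))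
               (∷-cong (≡.sym (ℚ.+-identityʳ 0ℚ)) (*ₚ-distribʳ q p p′)) ⟩
  (scaleₚ a q +ₚ scaleₚ b q) +ₚ ((0ℚ ∷ p *ₚ q) +ₚ (0ℚ ∷ p′ *ₚ q))
    ≡⟨ interchange (scaleₚ a q) (scaleₚ b q) _ _ ⟩
  (scaleₚ a q +ₚ (0ℚ ∷ p *ₚ q)) +ₚ (scaleₚ b q +ₚ (0ℚ ∷ p′ *ₚ q)) ∎

*ₚ-distribˡ : ∀ p q q′ → p *ₚ (q +ₚ q′) ≋ p *ₚ q +ₚ p *ₚ q′
*ₚ-distribˡ p q q′ = begin
  p *ₚ (q +ₚ q′)     ≈⟨ *ₚ-comm p (q +ₚ q′) ⟩
  (q +ₚ q′) *ₚ p     ≈⟨ *ₚ-distribʳ p q q′ ⟩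
  q *ₚ p +ₚ q′ *ₚ p  ≈⟨ +ₚ-cong (*ₚ-comm q p) (*ₚ-comm q′ p) ⟩
  p *ₚ q +ₚ p *ₚ q′  ∎

scaleₚ-*ₚ : ∀ a p q → scaleₚ a p *ₚ q ≋ scaleₚ a (p *ₚ q)
scaleₚ-*ₚ a []      q = ≋-refl
scaleₚ-*ₚ a (b ∷ p) q = begin
  scaleₚ (a * b) q +ₚ (0ℚ ∷ scaleₚ a p *ₚ q)
    ≈⟨ +ₚ-cong (≋-reflexive (scaleₚ-assoc a b q)) (∷-cong (≡.sym (ℚ.*-zeroʳ a)) (scaleₚ-*ₚ a p q)) ⟩
  scaleₚ a (scaleₚ b q) +ₚ scaleₚ a (0ℚ ∷ p *ₚ q)
    ≡⟨ scaleₚ-distribˡ a (scaleₚ b q) _ ⟨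
  scaleₚ a (scaleₚ b q +ₚ (0ℚ ∷ p *ₚ q)) ∎

*ₚ-assoc : ∀ p q r → (p *ₚ q) *ₚ r ≋ p *ₚ (q *ₚ r)
*ₚ-assoc []      q r = ≋-refl
*ₚ-assoc (a ∷ p) q r = begin
  (scaleₚ a q +ₚ (0ℚ ∷ p *ₚ q)) *ₚ r         ≈⟨ *ₚ-distribʳ r (scaleₚ a q) _ ⟩
  scaleₚ a q *ₚ r +ₚ (0ℚ ∷ p *ₚ q) *ₚ r      ≈⟨ +ₚ-cong (scaleₚ-*ₚ a q r) (+ₚ-cong (scaleₚ-zero r) ≋-refl) ⟩
  scaleₚ a (q *ₚ r) +ₚ (0ℚ ∷ (p *ₚ q) *ₚ r)  ≈⟨ +ₚ-cong ≋-refl (∷-cong refl (*ₚ-assoc p q r)) ⟩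
  scaleₚ a (q *ₚ r) +ₚ (0ℚ ∷ p *ₚ (q *ₚ r))  ∎

*ₚ-identityˡ : ∀ p → constₚ 1ℚ *ₚ p ≋ p
*ₚ-identityˡ p = begin
  scaleₚ 1ℚ p +ₚ (0ℚ ∷ [])  ≈⟨ +ₚ-cong ≋-refl (∷-zero refl ≋-refl) ⟩
  scaleₚ 1ℚ p +ₚ []         ≡⟨ ≡.trans (+ₚ-identityʳ _) (scaleₚ-identity p) ⟩
  p                         ∎

*ₚ-identityʳ : ∀ p → p *ₚ constₚ 1ℚ ≋ p
*ₚ-identityʳ p = ≋-trans (*ₚ-comm p (constₚ 1ℚ)) (*ₚ-identityˡ p)

ℚ[X] : CommutativeRing 0ℓ 0ℓ
ℚ[X] = record
  { Carrier = Poly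
  ; _≈_ = _≋_
  ; _+_ = _+ₚ_
  ; _*_ = _*ₚ_
  ; -_ = negₚ
  ; 0# = []
  ; 1# = constₚ 1ℚ
  ; isCommutativeRing = record
    { isRing = record
      { +-isAbelianGroup = record
        { isGroup = record
          { isMonoid = record
            { isSemigroup = record
              { isMagma = record { isEquivalence = ≋-isEquivalence ; ∙-cong = +ₚ-cong }
              ; assoc = λ p q r → ≋-reflexive (+ₚ-assoc p q r)
              }
            ; identity = (λ p → ≋-refl) , (λ p → ≋-reflexive (+ₚ-identityʳ p))
            }
          ; inverse = negₚ-inverseˡ , negₚ-inverseʳ
          ; ⁻¹-cong = negₚ-cong
          }
        ; comm = λ p q → ≋-reflexive (+ₚ-comm p q)
        }
      ; *-cong = λ {p} {p′} p≋p′ q≋q′ → ≋-trans (*ₚ-congʳ p≋p′) (*ₚ-congˡ {p′} q≋q′)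
      ; *-assoc = *ₚ-assoc
      ; *-identity = *ₚ-identityˡ , *ₚ-identityʳ
      ; distrib = *ₚ-distribˡ , *ₚ-distribʳ
      }
    ; *-comm = *ₚ-comm
    }
  }

coeff-drop1 : ∀ p n → coeff (drop 1 p) n ≡ coeff p (suc n)
coeff-drop1 []      n = refl
coeff-drop1 (a ∷ p) n = refl

≋-uncons : ∀ {p q} → (coeff p 0 ≡ coeff q 0 × drop 1 p ≋ drop 1 q) ⇔ p ≋ q
≋-uncons {p} {q} = mk⇔ to from
  where
  to : coeff p 0 ≡ coeff q 0 × drop 1 p ≋ drop 1 q → p ≋ q
  to (head≡ , coeffwise tail≡) = coeffwise λ
    { zero    → head≡
    ; (suc n) → ≡.trans (≡.sym (coeff-drop1 p n)) (≡.trans (tail≡ n) (coeff-drop1 q n))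
    }
  from : p ≋ q → coeff p 0 ≡ coeff q 0 × drop 1 p ≋ drop 1 q
  from (coeffwise e) = e 0 , coeffwise λ n →
    ≡.trans (coeff-drop1 p n) (≡.trans (e (suc n)) (≡.sym (coeff-drop1 q n)))

_≋?_ : Decidable _≋_
[]      ≋? []      = yes ≋-refl
[]      ≋? (b ∷ q) = Dec.map ≋-uncons (0ℚ ℚ.≟ b ×-dec [] ≋? q)
(a ∷ p) ≋? []      = Dec.map ≋-uncons (a ℚ.≟ 0ℚ ×-dec p ≋? [])
(a ∷ p) ≋? (b ∷ q) = Dec.map ≋-uncons (a ℚ.≟ b ×-dec p ≋? q)

open import Algebra.Definitions.RawMagma (CommutativeRing.*-rawMagma ℚ[X]) using (_∣ˡ_; _,_)
open import Algebra.Properties.Semiring.Exp (CommutativeRing.semiring ℚ[X]) using (_^_)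

∣ˡ-byQuotient : ∀ d q p → {True (d *ₚ q ≋? p)} → d ∣ˡ p
∣ˡ-byQuotient d q p {d*q≋p} = q , toWitness d*q≋p

∣ˡ⇒∣ₚ : ∀ {p q} → p ∣ˡ q → p ∣ₚ q
∣ˡ⇒∣ₚ (r , p*r≋q) = r , coeff-≡ p*r≋q

^≡^ₚ : ∀ p n → p ^ n ≡ p ^ₚ n
^≡^ₚ p zero    = refl
^≡^ₚ p (suc n) = ≡.cong (p *ₚ_) (^≡^ₚ p n)

-- Stated with the ring power _^_, which agrees with _^ₚ_ definitionally only for numerals n and r.
Tₖ-divisible : ∀ {P} n r .{{_ : NonZero n}} → P ∣ˡ X ^ n -ₚ X-1 ^ n →
               P ∣ˡ X ^ r *ₚ compose P X+1 -ₚ X-1 ^ r *ₚ compose P X-1 →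
               ∀ k → k % n ≡ r → P ∣ₚ Tₖ k P
Tₖ-divisible {P} n r P∣Xⁿ-[X-1]ⁿ P∣Tᵣ k k%n≡r =
  ∣ˡ⇒∣ₚ (≡.subst (P ∣ˡ_) ring-form≡Tₖ (∣ˡ-^-mod ℚ[X] n r P∣Xⁿ-[X-1]ⁿ P∣Tᵣ k k%n≡r))
  where
  ring-form≡Tₖ : X ^ k *ₚ compose P X+1 -ₚ X-1 ^ k *ₚ compose P X-1 ≡ Tₖ k P
  ring-form≡Tₖ = ≡.cong₂ (λ u v → u *ₚ compose P X+1 -ₚ v *ₚ compose P X-1) (^≡^ₚ X k) (^≡^ₚ X-1 k)

P₁∣X²-[X-1]² : P₁ ∣ˡ X ^ₚ 2 -ₚ X-1 ^ₚ 2
P₁∣X²-[X-1]² = ∣ˡ-byQuotient P₁ (constₚ 1ℚ) _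

P₁∣T₁P₁ : P₁ ∣ˡ Tₖ 1 P₁
P₁∣T₁P₁ = ∣ˡ-byQuotient P₁ (constₚ (fromℤ (+ 3))) _

P₂∣X⁴-[X-1]⁴ : P₂ ∣ˡ X ^ₚ 4 -ₚ X-1 ^ₚ 4
P₂∣X⁴-[X-1]⁴ = ∣ˡ-byQuotient P₂ P₁ _

P₂∣T₁P₂ : P₂ ∣ˡ Tₖ 1 P₂
P₂∣T₁P₂ = ∣ˡ-byQuotient P₂ (constₚ (fromℤ (+ 5))) _

P₃∣X⁶-[X-1]⁶ : P₃ ∣ˡ X ^ₚ 6 -ₚ X-1 ^ₚ 6
P₃∣X⁶-[X-1]⁶ = ∣ˡ-byQuotient P₃ (- 1ℚ ∷ fromℤ (+ 5) ∷ - fromℤ (+ 9) ∷ fromℤ (+ 6) ∷ []) _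

P₃∣T₂P₃ : P₃ ∣ˡ Tₖ 2 P₃
P₃∣T₂P₃ = ∣ˡ-byQuotient P₃ (- fromℤ (+ 3) ∷ fromℤ (+ 6) ∷ []) _

mainTheorem4 : (k : ℕ) → 2 ≤ k →
    ((k % 2 ≡ 1 → P₁ ∣ₚ Tₖ k P₁) ×
     (k % 4 ≡ 1 → P₂ ∣ₚ Tₖ k P₂) ×
     (k % 6 ≡ 2 → P₃ ∣ₚ Tₖ k P₃))
mainTheorem4 k _ =
  Tₖ-divisible 2 1 P₁∣X²-[X-1]² P₁∣T₁P₁ k ,
  Tₖ-divisible 4 1 P₂∣X⁴-[X-1]⁴ P₂∣T₁P₂ k ,
  Tₖ-divisible 6 2 P₃∣X⁶-[X-1]⁶ P₃∣T₂P₃ k
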